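{- Let $k\geq 2$ be an integer. Let $q$ be a prime power such that $q\equiv 1\pmod k$ if $q$ is even, or $q\equiv 1\pmod{2k}$ if $q$ is odd. Let $H_k(q)$ be the induced subgraph of $G_k(q)$ whose vertex set is the set of $k$-th power residues of $\mathbb{F}_q$, and let $H^1_k(q)$ be the induced subgraph of $H_k(q)$ whose vertex set is the set of neighbors of $1$ in $H_k(q)$. Then for every positive integer $n$: (a) $\mathcal{K}_{n+1}(G_k(q))=\frac{q}{n+1}\mathcal{K}_n(H_k(q))$; (b) $\mathcal{K}_{n+1}(H_k(q))=\frac{q-1}{k(n+1)}\mathcal{K}_n(H^1_k(q))$. Consequently, for $n\geq 2$: (c) $\mathcal{K}_{n+1}(G_k(q))=\frac{q(q-1)}{kn(n+1)}\mathcal{K}_{n-1}(H^1_k(q))$.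
   Context: $\mathcal{K}_m(G)$ is the number of complete subgraphs of order $m$ in a graph $G$. For $k,q$ as in the claim, $S_k$ is the subgroup of $\mathbb{F}_q^*$ of order $\frac{q-1}{k}$ of $k$-th power residues, and the generalized Paley graph $G_k(q)$ has vertex set $\mathbb{F}_q$ with $ab$ an edge iff $a-b\in S_k$. -}

module Defs where

open import Level using (0ℓ)
open import Data.Nat as ℕ using (ℕ; zero; suc)
open import Data.Nat.Primality using (Prime)
open import Data.Product using (Σ; ∃; _×_; _,_; proj₁; proj₂)
open import Data.List using (List; []; _∷_; length; map; _++_; filter; [_])
open import Data.List.Membership.Propositional using (_∈_)
open import Data.List.Relation.Unary.Unique.Propositional using (Unique)
open import Data.List.Relation.Unary.Any as Any using (Any; here; there)
open import Data.List.Relation.Unary.AllPairs using (AllPairs)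
import Data.List.Relation.Unary.AllPairs as AP
open import Relation.Nullary using (¬_; Dec; yes; no)
open import Relation.Nullary.Decidable using (_×-dec_; ¬?; map′)
open import Relation.Unary using (Pred; Decidable)
open import Relation.Binary.PropositionalEquality using (_≡_; refl)
open import Relation.Binary.Definitions using (DecidableEquality)
open import Data.Unit using (⊤; tt)
open import Algebra.Structures using (IsCommutativeRing)

IsPrimePower : ℕ → Set
IsPrimePower q = ∃ λ p → ∃ λ e → Prime p × (1 ℕ.≤ e) × (q ≡ p ℕ.^ e)

record FiniteField : Set₁ where
  infixl 6 _+_
  infixl 7 _*_
  field
    Carrier    : Set
    _+_ _*_    : Carrier → Carrier → Carrier
    -_         : Carrier → Carrier
    0# 1#      : Carrier
    isCommutativeRing : IsCommutativeRing _≡_ _+_ _*_ -_ 0# 1#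
    0≢1        : ¬ (0# ≡ 1#)
    inverse    : ∀ x → ¬ (x ≡ 0#) → ∃ λ y → x * y ≡ 1#
    _≟_        : DecidableEquality Carrier
    elements   : List Carrier
    unique     : Unique elements
    complete   : ∀ x → x ∈ elements

  order : ℕ
  order = length elements

  _-_ : Carrier → Carrier → Carrier
  x - y = x + (- y)

  _^_ : Carrier → ℕ → Carrier
  x ^ zero  = 1#
  x ^ suc n = x * (x ^ n)

-- All m-element sublists (m-subsets, if the list has no duplicates).
subsetsOfSize : {A : Set} → ℕ → List A → List (List A)
subsetsOfSize zero    _        = [ [] ]
subsetsOfSize (suc m) []       = []
subsetsOfSize (suc m) (x ∷ xs) = map (x ∷_) (subsetsOfSize m xs) ++ subsetsOfSize (suc m) xs

module _ (F : FiniteField) (k : ℕ) where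
  open FiniteField F

  S : Pred Carrier 0ℓ
  S x = ¬ (x ≡ 0#) × ∃ λ y → y ^ k ≡ x

  S? : Decidable S
  S? x = ¬? (x ≟ 0#) ×-dec
         map′ (λ a → Any.satisfied a)
              (λ { (y , e) → Any.map (λ { refl → e }) (complete y) })
              (Any.any? (λ y → (y ^ k) ≟ x) elements)

  Adj : Carrier → Carrier → Set
  Adj a b = S (a - b)

  Adj? : ∀ a b → Dec (Adj a b)
  Adj? a b = S? (a - b)

  cliquesIn : {V : Pred Carrier 0ℓ} → Decidable V → ℕ → ℕ
  cliquesIn V? m =
    length (filter (AP.allPairs? Adj?) (subsetsOfSize m (filter V? elements)))

  K-G : ℕ → ℕ
  K-G m = cliquesIn {V = λ _ → ⊤} (λ _ → yes tt) m

  K-H : ℕ → ℕ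
  K-H m = cliquesIn S? m

  H1 : Pred Carrier 0ℓ
  H1 x = S x × Adj 1# x

  H1? : Decidable H1
  H1? x = S? x ×-dec Adj? 1# x

  K-H1 : ℕ → ℕ
  K-H1 m = cliquesIn H1? m

module Submission where

-- When -1 is a k-th power, G_k(q) is an undirected graph on F_q
-- whose automorphisms include all translations x ↦ v + x and, fixing 0,
-- all multiplications x ↦ s x by s ∈ S_k.  By the handshake lemma for
-- cliques, (n+1) K_{n+1}(G) = Σ_v K_n(neighbourhood of v); translation
-- identifies every neighbourhood with H_k(q), giving (a), and inside H_k(q)
-- multiplication by s identifies the neighbourhood of s with H¹_k(q),
-- giving (n+1) K_{n+1}(H) = |S_k| K_n(H¹).  Then (b) needs |S_k| = (q-1)/k,
-- and the hypotheses on q must put -1 in S_k: both come from counting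
-- roots of unity with Fermat's little theorem and the root bound for
-- polynomials.  Part (c) is arithmetic from (a) and (b).

open import Defs
open import Level using (0ℓ)
open import Algebra.Bundles using (CommutativeRing)
open import Data.Nat as Nat using (ℕ; zero; suc; _≤_; _<_; z≤n; s≤s)
open import Data.Nat.Properties
  using (+-comm; +-assoc; *-comm; *-assoc; *-zeroʳ; *-identityʳ; *-identityˡ; *-mono-≤; *-cancelʳ-≤; *-cancelʳ-≡; <-≤-trans;
         ≤-trans; ≤-reflexive; ≤-antisym; <-irrefl)
open import Data.Nat.Divisibility using (_∣_; _∣?_; divides; ∣-trans; ∣1⇒≡1; ∣m+n∣m⇒∣n)
open import Data.Nat.ListAction using (sum)
open import Data.Nat.Tactic.RingSolver using (solve-∀)
open import Data.Product using (∃; _×_; _,_; proj₁; proj₂) renaming (swap to ×-swap)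
open import Data.Bool using (true; false)
open import Data.Unit using (tt)
open import Data.Empty using (⊥-elim)
open import Data.List using (List; []; _∷_; length; map; _++_; filter; foldr; replicate)
open import Data.List.Properties
  using (length-++; length-filter; length-map; length-replicate; map-++; map-∘;
         filter-++; filter-≐; filter-none; filter-some; filter-all; filter-accept; filter-reject; filter-notAll)
open import Data.List.Relation.Unary.All as All using (All; []; _∷_)
open import Data.List.Relation.Unary.Any as Any using (here; there)
open import Data.List.Relation.Unary.Unique.Propositional using (Unique)
import Data.List.Relation.Unary.Unique.Propositional.Properties as Uniqueₚ
open import Data.List.Membership.Propositional using (_∈_)
open import Data.List.Membership.Propositional.Properties using (∈-filter⁺; ∈-filter⁻; ∈-map⁺; ∈-map⁻)
open import Data.List.Membership.Propositional.Properties.WithK using (unique∧set⇒bag)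
open import Data.List.Relation.Binary.BagAndSetEquality using (∼bag⇒↭)
open import Data.List.Relation.Unary.AllPairs using (AllPairs; []; _∷_)
import Data.List.Relation.Unary.AllPairs as AllPairs
import Data.List.Relation.Unary.AllPairs.Properties as AllPairsₚ
open import Data.List.Relation.Binary.Permutation.Propositional using (_↭_; refl; prep; swap; trans; ↭-sym; ↭⇒↭ₛ)
open import Data.List.Relation.Binary.Permutation.Propositional.Properties using (filter-↭; ↭-length)
open import Relation.Nullary using (¬_; Dec; yes; no; does)
open import Relation.Nullary.Decidable using (_×-dec_; ¬?)
open import Relation.Unary using (Pred; Decidable)
open import Relation.Binary.Definitions using (DecidableEquality)
open import Function.Bundles using (mk⇔)
open import Function using (case_of_)
import Relation.Binary.PropositionalEquality as ≡
open import Relation.Binary.PropositionalEquality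
  using (_≡_; refl; sym; cong; cong₂; subst; module ≡-Reasoning)
  renaming (trans to ≡-trans)

subsetsOfSize-map : {A B : Set} (f : A → B) → ∀ m L → subsetsOfSize m (map f L) ≡ map (map f) (subsetsOfSize m L)
subsetsOfSize-map f zero    L       = refl
subsetsOfSize-map f (suc m) []      = refl
subsetsOfSize-map f (suc m) (x ∷ L) = begin
    map (f x ∷_) (subsetsOfSize m (map f L)) ++ subsetsOfSize (suc m) (map f L)
      ≡⟨ cong₂ _++_ (cong (map (f x ∷_)) (subsetsOfSize-map f m L)) (subsetsOfSize-map f (suc m) L) ⟩
    map (f x ∷_) (map (map f) (subsetsOfSize m L)) ++ map (map f) (subsetsOfSize (suc m) L)
      -- both sides send C to f x ∷ map f C
      ≡⟨ cong (_++ map (map f) (subsetsOfSize (suc m) L))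
              (≡-trans (sym (map-∘ (subsetsOfSize m L))) (map-∘ (subsetsOfSize m L))) ⟩
    map (map f) (map (x ∷_) (subsetsOfSize m L)) ++ map (map f) (subsetsOfSize (suc m) L)
      ≡⟨ map-++ (map f) (map (x ∷_) (subsetsOfSize m L)) _ ⟨
    map (map f) (subsetsOfSize (suc m) (x ∷ L)) ∎
  where open ≡-Reasoning

filter-∩ : {A : Set} {P Q : Pred A 0ℓ} (P? : Decidable P) (Q? : Decidable Q) →
           ∀ L → filter Q? (filter P? L) ≡ filter (λ x → P? x ×-dec Q? x) L
filter-∩ P? Q? [] = refl
filter-∩ P? Q? (x ∷ L) with P? x | Q? x
... | yes px | yes qx = ≡-trans (filter-accept Q? qx) (cong (x ∷_) (filter-∩ P? Q? L))
... | yes px | no ¬qx = ≡-trans (filter-reject Q? ¬qx) (filter-∩ P? Q? L)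
... | no ¬px | _      = filter-∩ P? Q? L

module _ {A : Set} {T : Pred A 0ℓ} (T? : Decidable T) where

  open Nat using (_+_)

  count-++ : ∀ xs ys → length (filter T? (xs ++ ys)) ≡ length (filter T? xs) + length (filter T? ys)
  count-++ xs ys = ≡-trans (cong length (filter-++ T? xs ys)) (length-++ (filter T? xs))

  count-map : {B : Set} (f : B → A) (xs : List B) → length (filter T? (map f xs)) ≡ length (filter (λ x → T? (f x)) xs)
  count-map f []       = refl
  count-map f (x ∷ xs) with does (T? (f x))
  ... | true  = cong suc (count-map f xs)
  ... | false = count-map f xs

module Sums {A : Set} where

  open Nat using (_+_; _*_)

  sum-const : (c : ℕ) (L : List A) → sum (map (λ _ → c) L) ≡ length L * c
  sum-const c []      = refl
  sum-const c (x ∷ L) = cong (c +_) (sum-const c L)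

  sum-cong : (f g : A → ℕ) (L : List A) → (∀ {x} → x ∈ L → f x ≡ g x) → sum (map f L) ≡ sum (map g L)
  sum-cong f g []      eq = refl
  sum-cong f g (x ∷ L) eq = cong₂ _+_ (eq (here refl)) (sum-cong f g L (λ x∈L → eq (there x∈L)))

  sum-split : {P : Pred A 0ℓ} (P? : Decidable P) (f h g : A → ℕ) →
              (∀ x → P x → f x ≡ h x + g x) → (∀ x → ¬ P x → f x ≡ h x) →
              ∀ L → sum (map f L) ≡ sum (map h L) + sum (map g (filter P? L))
  sum-split P? f h g onP offP [] = refl
  sum-split P? f h g onP offP (x ∷ L) with P? x
  ... | yes px = begin
      f x + sum (map f L)                                     ≡⟨ cong₂ _+_ (onP x px) (sum-split P? f h g onP offP L) ⟩
      (h x + g x) + (sum (map h L) + sum (map g (filter P? L))) ≡⟨ interchange (h x) (g x) _ _ ⟩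
      (h x + sum (map h L)) + (g x + sum (map g (filter P? L))) ∎
    where
    open ≡-Reasoning
    interchange : ∀ a b c d → (a + b) + (c + d) ≡ (a + c) + (b + d)
    interchange = solve-∀
  ... | no ¬px = begin
      f x + sum (map f L)                                     ≡⟨ cong₂ _+_ (offP x ¬px) (sum-split P? f h g onP offP L) ⟩
      h x + (sum (map h L) + sum (map g (filter P? L)))        ≡⟨ +-assoc (h x) _ _ ⟨
      (h x + sum (map h L)) + sum (map g (filter P? L)) ∎
    where open ≡-Reasoning

module Cliques {A : Set} (R : A → A → Set) (R? : ∀ a b → Dec (R a b)) where

  open Nat using (_+_; _*_)
  open Sums

  IsClique : List A → Set
  IsClique = AllPairs R

  clique? : (C : List A) → Dec (IsClique C)
  clique? = AllPairs.allPairs? R?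

  cliques : List A → ℕ → ℕ
  cliques L m = length (filter clique? (subsetsOfSize m L))

  nbrs : A → List A → List A
  nbrs x = filter (R? x)

  count-subsets-filter : {P : Pred A 0ℓ} (P? : Decidable P) {T : Pred (List A) 0ℓ} (T? : Decidable T) →
    ∀ m L → length (filter (λ C → All.all? P? C ×-dec T? C) (subsetsOfSize m L))
          ≡ length (filter T? (subsetsOfSize m (filter P? L)))
  count-subsets-filter P? T? zero L with T? []
  ... | yes _ = refl
  ... | no _  = refl
  count-subsets-filter P? T? (suc m) [] = refl
  count-subsets-filter {P} P? {T} T? (suc m) (x ∷ L) with P? x
  ... | yes px = begin
      length (filter Q? (map (x ∷_) (subsetsOfSize m L) ++ subsetsOfSize (suc m) L))
        ≡⟨ count-++ Q? (map (x ∷_) (subsetsOfSize m L)) _ ⟩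
      length (filter Q? (map (x ∷_) (subsetsOfSize m L))) + length (filter Q? (subsetsOfSize (suc m) L))
        ≡⟨ cong₂ _+_ heads (count-subsets-filter P? T? (suc m) L) ⟩
      length (filter T? (map (x ∷_) (subsetsOfSize m (filter P? L)))) + length (filter T? (subsetsOfSize (suc m) (filter P? L)))
        ≡⟨ count-++ T? (map (x ∷_) (subsetsOfSize m (filter P? L))) _ ⟨
      length (filter T? (subsetsOfSize (suc m) (x ∷ filter P? L))) ∎
    where
    open ≡-Reasoning
    Q? : Decidable (λ C → All P C × T C)
    Q? C = All.all? P? C ×-dec T? C
    -- sublists through x: the condition on x itself holds and drops out
    heads : length (filter Q? (map (x ∷_) (subsetsOfSize m L)))
          ≡ length (filter T? (map (x ∷_) (subsetsOfSize m (filter P? L))))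
    heads = begin
      length (filter Q? (map (x ∷_) (subsetsOfSize m L)))
        ≡⟨ count-map Q? (x ∷_) (subsetsOfSize m L) ⟩
      length (filter (λ C → Q? (x ∷ C)) (subsetsOfSize m L))
        ≡⟨ cong length (filter-≐ (λ C → Q? (x ∷ C)) (λ C → All.all? P? C ×-dec T? (x ∷ C))
                          ((λ { ((_ ∷ ps) , t) → ps , t }) , (λ { (ps , t) → (px ∷ ps) , t }))
                          (subsetsOfSize m L)) ⟩
      length (filter (λ C → All.all? P? C ×-dec T? (x ∷ C)) (subsetsOfSize m L))
        ≡⟨ count-subsets-filter P? (λ C → T? (x ∷ C)) m L ⟩
      length (filter (λ C → T? (x ∷ C)) (subsetsOfSize m (filter P? L)))
        ≡⟨ count-map T? (x ∷_) (subsetsOfSize m (filter P? L)) ⟨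
      length (filter T? (map (x ∷_) (subsetsOfSize m (filter P? L)))) ∎
  ... | no ¬px = begin
      length (filter Q? (map (x ∷_) (subsetsOfSize m L) ++ subsetsOfSize (suc m) L))
        ≡⟨ count-++ Q? (map (x ∷_) (subsetsOfSize m L)) _ ⟩
      length (filter Q? (map (x ∷_) (subsetsOfSize m L))) + length (filter Q? (subsetsOfSize (suc m) L))
        ≡⟨ cong₂ _+_ noHeads (count-subsets-filter P? T? (suc m) L) ⟩
      length (filter T? (subsetsOfSize (suc m) (filter P? L))) ∎
    where
    open ≡-Reasoning
    Q? : Decidable (λ C → All P C × T C)
    Q? C = All.all? P? C ×-dec T? C
    noHeads : length (filter Q? (map (x ∷_) (subsetsOfSize m L))) ≡ 0
    noHeads = ≡-trans (count-map Q? (x ∷_) (subsetsOfSize m L))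
                      (cong length (filter-none (λ C → Q? (x ∷ C)) {xs = subsetsOfSize m L} (All.tabulate (λ { _ ((p ∷ _) , _) → ¬px p }))))

  -- An (m+1)-clique on x ∷ L either contains x, and is then x followed by
  -- an m-clique among the neighbours of x in L, or it is a clique on L.
  cliques-cons : ∀ x L m → cliques (x ∷ L) (suc m) ≡ cliques (nbrs x L) m + cliques L (suc m)
  cliques-cons x L m = begin
      length (filter clique? (map (x ∷_) (subsetsOfSize m L) ++ subsetsOfSize (suc m) L))
        ≡⟨ count-++ clique? (map (x ∷_) (subsetsOfSize m L)) _ ⟩
      length (filter clique? (map (x ∷_) (subsetsOfSize m L))) + cliques L (suc m)
        ≡⟨ cong (_+ cliques L (suc m)) throughX ⟩
      cliques (nbrs x L) m + cliques L (suc m) ∎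
    where
    open ≡-Reasoning
    throughX : length (filter clique? (map (x ∷_) (subsetsOfSize m L))) ≡ cliques (nbrs x L) m
    throughX = begin
      length (filter clique? (map (x ∷_) (subsetsOfSize m L)))
        ≡⟨ count-map clique? (x ∷_) (subsetsOfSize m L) ⟩
      length (filter (λ C → clique? (x ∷ C)) (subsetsOfSize m L))
        ≡⟨ cong length (filter-≐ (λ C → clique? (x ∷ C)) (λ C → All.all? (R? x) C ×-dec clique? C)
                          ((λ { (r ∷ c) → r , c }) , (λ { (r , c) → r ∷ c })) (subsetsOfSize m L)) ⟩
      length (filter (λ C → All.all? (R? x) C ×-dec clique? C) (subsetsOfSize m L))
        ≡⟨ count-subsets-filter (R? x) clique? m L ⟩
      cliques (nbrs x L) m ∎

  cliques-1 : ∀ L → cliques L 1 ≡ length L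
  cliques-1 []      = refl
  cliques-1 (x ∷ L) = ≡-trans (cliques-cons x L 0) (cong suc (cliques-1 L))

  cliques-map : (f : A → A) → (∀ {a b} → R a b → R (f a) (f b)) → (∀ {a b} → R (f a) (f b) → R a b) →
                ∀ L m → cliques (map f L) m ≡ cliques L m
  cliques-map f pres refl′ L m = begin
      length (filter clique? (subsetsOfSize m (map f L)))
        ≡⟨ cong (λ Cs → length (filter clique? Cs)) (subsetsOfSize-map f m L) ⟩
      length (filter clique? (map (map f) (subsetsOfSize m L)))
        ≡⟨ count-map clique? (map f) (subsetsOfSize m L) ⟩
      length (filter (λ C → clique? (map f C)) (subsetsOfSize m L))
        ≡⟨ cong length (filter-≐ (λ C → clique? (map f C)) clique?
                          ((λ c → AllPairs.map refl′ (AllPairsₚ.map⁻ c)) , (λ c → AllPairsₚ.map⁺ (AllPairs.map pres c)))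
                          (subsetsOfSize m L)) ⟩
      cliques L m ∎
    where open ≡-Reasoning

  module Undirected (R-sym : ∀ {a b} → R a b → R b a) (R-irrefl : ∀ a → ¬ R a a) where

    nbrs-self : ∀ x L → nbrs x (x ∷ L) ≡ nbrs x L
    nbrs-self x L = filter-reject (R? x) (R-irrefl x)

    nbrs-comm : ∀ x y L → nbrs x (nbrs y L) ≡ nbrs y (nbrs x L)
    nbrs-comm x y L = begin
        filter (R? x) (filter (R? y) L)              ≡⟨ filter-∩ (R? y) (R? x) L ⟩
        filter (λ z → R? y z ×-dec R? x z) L        ≡⟨ filter-≐ _ _ (×-swap , ×-swap) L ⟩
        filter (λ z → R? x z ×-dec R? y z) L        ≡⟨ filter-∩ (R? x) (R? y) L ⟨
        filter (R? y) (filter (R? x) L) ∎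
      where open ≡-Reasoning

    cliques-↭ : ∀ m {L L′} → L ↭ L′ → cliques L m ≡ cliques L′ m

    -- The cliques through x or through y on x ∷ y ∷ L: symmetric in x and y.
    swap-nbrs : ∀ m x y {xs ys} → xs ↭ ys →
                cliques (nbrs x (y ∷ xs)) m + cliques (nbrs y xs) m
                ≡ cliques (nbrs y (x ∷ ys)) m + cliques (nbrs x ys) m

    cliques-↭ zero    _            = refl
    cliques-↭ (suc m) refl         = refl
    cliques-↭ (suc m) (trans p p′) = ≡-trans (cliques-↭ (suc m) p) (cliques-↭ (suc m) p′)
    cliques-↭ (suc m) (prep {xs} {ys} x p) = begin
        cliques (x ∷ xs) (suc m)                   ≡⟨ cliques-cons x xs m ⟩
        cliques (nbrs x xs) m + cliques xs (suc m) ≡⟨ cong₂ _+_ (cliques-↭ m (filter-↭ (R? x) p)) (cliques-↭ (suc m) p) ⟩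
        cliques (nbrs x ys) m + cliques ys (suc m) ≡⟨ cliques-cons x ys m ⟨
        cliques (x ∷ ys) (suc m) ∎
      where open ≡-Reasoning
    cliques-↭ (suc m) (swap {xs} {ys} x y p) = begin
        cliques (x ∷ y ∷ xs) (suc m)
          ≡⟨ expand x y xs ⟩
        cliques (nbrs x (y ∷ xs)) m + cliques (nbrs y xs) m + cliques xs (suc m)
          ≡⟨ cong₂ _+_ (swap-nbrs m x y p) (cliques-↭ (suc m) p) ⟩
        cliques (nbrs y (x ∷ ys)) m + cliques (nbrs x ys) m + cliques ys (suc m)
          ≡⟨ expand y x ys ⟨
        cliques (y ∷ x ∷ ys) (suc m) ∎
      where
      open ≡-Reasoning
      expand : ∀ u v L → cliques (u ∷ v ∷ L) (suc m)
                         ≡ cliques (nbrs u (v ∷ L)) m + cliques (nbrs v L) m + cliques L (suc m)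
      expand u v L = ≡-trans (cliques-cons u (v ∷ L) m)
                       (≡-trans (cong (cliques (nbrs u (v ∷ L)) m +_) (cliques-cons v L m))
                                (sym (+-assoc (cliques (nbrs u (v ∷ L)) m) _ _)))

    swap-nbrs m x y {xs} {ys} p with R? x y | R? y x
    swap-nbrs m x y p | yes xy | no ¬yx = ⊥-elim (¬yx (R-sym xy))
    swap-nbrs m x y p | no ¬xy | yes yx = ⊥-elim (¬xy (R-sym yx))
    swap-nbrs m x y {xs} {ys} p | no _ | no _ =
      ≡-trans (+-comm (cliques (nbrs x xs) m) _)
              (cong₂ _+_ (cliques-↭ m (filter-↭ (R? y) p)) (cliques-↭ m (filter-↭ (R? x) p)))
    swap-nbrs zero    x y p | yes _ | yes _ = refl
    swap-nbrs (suc n) x y {xs} {ys} p | yes _ | yes _ = begin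
        cliques (y ∷ nbrs x xs) (suc n) + cliques (nbrs y xs) (suc n)
          ≡⟨ cong (_+ cliques (nbrs y xs) (suc n)) (cliques-cons y (nbrs x xs) n) ⟩
        cliques (nbrs y (nbrs x xs)) n + cliques (nbrs x xs) (suc n) + cliques (nbrs y xs) (suc n)
          ≡⟨ cong₂ _+_ (cong₂ _+_ common (cliques-↭ (suc n) (filter-↭ (R? x) p)))
                       (cliques-↭ (suc n) (filter-↭ (R? y) p)) ⟩
        cliques (nbrs x (nbrs y ys)) n + cliques (nbrs x ys) (suc n) + cliques (nbrs y ys) (suc n)
          ≡⟨ exchange (cliques (nbrs x (nbrs y ys)) n) _ _ ⟩
        cliques (nbrs x (nbrs y ys)) n + cliques (nbrs y ys) (suc n) + cliques (nbrs x ys) (suc n)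
          ≡⟨ cong (_+ cliques (nbrs x ys) (suc n)) (cliques-cons x (nbrs y ys) n) ⟨
        cliques (x ∷ nbrs y ys) (suc n) + cliques (nbrs x ys) (suc n) ∎
      where
      open ≡-Reasoning
      common : cliques (nbrs y (nbrs x xs)) n ≡ cliques (nbrs x (nbrs y ys)) n
      common = ≡-trans (cong (λ L → cliques L n) (nbrs-comm y x xs))
                       (cliques-↭ n (filter-↭ (R? x) (filter-↭ (R? y) p)))
      exchange : ∀ a b c → a + b + c ≡ a + c + b
      exchange = solve-∀

    -- Handshake lemma for cliques: both sides count the pairs (x , C) with
    -- C an (m+1)-clique on L and x ∈ C.
    handshake : ∀ m L → suc m * cliques L (suc m) ≡ sum (map (λ x → cliques (nbrs x L) m) L)
    handshake zero L = begin
        1 * cliques L 1         ≡⟨ *-identityˡ (cliques L 1) ⟩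
        cliques L 1             ≡⟨ cliques-1 L ⟩
        length L                ≡⟨ *-identityʳ (length L) ⟨
        length L * 1            ≡⟨ sum-const 1 L ⟨
        sum (map (λ _ → 1) L) ∎
      where open ≡-Reasoning
    handshake (suc m) [] = *-zeroʳ (suc (suc m))
    handshake (suc m) (y ∷ L) = begin
        suc (suc m) * cliques (y ∷ L) (suc (suc m))
          ≡⟨ cong (suc (suc m) *_) (cliques-cons y L (suc m)) ⟩
        suc (suc m) * (a + b)
          ≡⟨ distribute a b m ⟩
        a + (suc (suc m) * b + suc m * a)
          ≡⟨ cong (a +_) (cong₂ _+_ (handshake (suc m) L) (handshake m (nbrs y L))) ⟩
        a + (sum (map (λ x → cliques (nbrs x L) (suc m)) L) + sum (map (λ x → cliques (nbrs x (nbrs y L)) m) (nbrs y L)))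
          ≡⟨ cong (a +_) (sum-split (R? y) (λ x → cliques (nbrs x (y ∷ L)) (suc m)) _ _ viaY notViaY L) ⟨
        a + sum (map (λ x → cliques (nbrs x (y ∷ L)) (suc m)) L)
          ≡⟨ cong (λ N → cliques N (suc m) + sum (map (λ x → cliques (nbrs x (y ∷ L)) (suc m)) L)) (nbrs-self y L) ⟨
        sum (map (λ x → cliques (nbrs x (y ∷ L)) (suc m)) (y ∷ L)) ∎
      where
      open ≡-Reasoning
      a = cliques (nbrs y L) (suc m)
      b = cliques L (suc (suc m))
      distribute : ∀ a b m → suc (suc m) * (a + b) ≡ a + (suc (suc m) * b + suc m * a)
      distribute = solve-∀
      -- a neighbour x of y sees y as an extra neighbour
      viaY : ∀ x → R y x → cliques (nbrs x (y ∷ L)) (suc m)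
                           ≡ cliques (nbrs x L) (suc m) + cliques (nbrs x (nbrs y L)) m
      viaY x yx = begin
        cliques (nbrs x (y ∷ L)) (suc m)                              ≡⟨ cong (λ N → cliques N (suc m)) (filter-accept (R? x) (R-sym yx)) ⟩
        cliques (y ∷ nbrs x L) (suc m)                                ≡⟨ cliques-cons y (nbrs x L) m ⟩
        cliques (nbrs y (nbrs x L)) m + cliques (nbrs x L) (suc m)    ≡⟨ +-comm _ (cliques (nbrs x L) (suc m)) ⟩
        cliques (nbrs x L) (suc m) + cliques (nbrs y (nbrs x L)) m    ≡⟨ cong (λ N → cliques (nbrs x L) (suc m) + cliques N m) (nbrs-comm y x L) ⟩
        cliques (nbrs x L) (suc m) + cliques (nbrs x (nbrs y L)) m ∎
      notViaY : ∀ x → ¬ R y x → cliques (nbrs x (y ∷ L)) (suc m) ≡ cliques (nbrs x L) (suc m)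
      notViaY x ¬yx = cong (λ N → cliques N (suc m)) (filter-reject (R? x) (λ xy → ¬yx (R-sym xy)))

module Enumerated {A : Set} (_≟_ : DecidableEquality A)
                  (elements : List A) (unique : Unique elements) (complete : ∀ x → x ∈ elements) where

  open Nat using (_+_; _*_)
  open Sums
  open import Data.List.Membership.DecPropositional _≟_ using (_∈?_)

  ↭-same-members : {xs ys : List A} → Unique xs → Unique ys →
                   (∀ {x} → x ∈ xs → x ∈ ys) → (∀ {x} → x ∈ ys → x ∈ xs) → xs ↭ ys
  ↭-same-members uxs uys xs⊆ys ys⊆xs = ∼bag⇒↭ (unique∧set⇒bag uxs uys (mk⇔ xs⊆ys ys⊆xs))

  module _ {xs ys : List A} (uxs : Unique xs) (uys : Unique ys) (xs⊆ys : ∀ {x} → x ∈ xs → x ∈ ys) where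

    private
      xs↭ys∩xs : xs ↭ filter (_∈? xs) ys
      xs↭ys∩xs = ↭-same-members uxs (Uniqueₚ.filter⁺ (_∈? xs) uys)
                   (λ x∈xs → ∈-filter⁺ (_∈? xs) (xs⊆ys x∈xs) x∈xs)
                   (λ x∈ys∩xs → proj₂ (∈-filter⁻ (_∈? xs) {xs = ys} x∈ys∩xs))

    length-⊆ : length xs ≤ length ys
    length-⊆ = ≤-trans (≤-reflexive (↭-length xs↭ys∩xs)) (length-filter (_∈? xs) ys)

    length-⊂ : ∀ {y} → y ∈ ys → ¬ y ∈ xs → length xs < length ys
    length-⊂ y∈ys y∉xs = ≤-trans (s≤s (≤-reflexive (↭-length xs↭ys∩xs)))
                                  (filter-notAll (_∈? xs) ys (Any.map (λ { refl → y∉xs }) y∈ys))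

  module _ {P : Pred A 0ℓ} (P? : Decidable P) where

    members : List A
    members = filter P? elements

    size : ℕ
    size = length members

    members-unique : Unique members
    members-unique = Uniqueₚ.filter⁺ P? unique

    ∈-members : ∀ {x} → P x → x ∈ members
    ∈-members {x} px = ∈-filter⁺ P? (complete x) px

    members-∈ : ∀ {x} → x ∈ members → P x
    members-∈ x∈ = proj₂ (∈-filter⁻ P? {xs = elements} x∈)

  module _ {P Q : Pred A 0ℓ} (P? : Decidable P) (Q? : Decidable Q) where

    size-mono : (∀ x → P x → Q x) → size P? ≤ size Q?
    size-mono P⊆Q = length-⊆ (members-unique P?) (members-unique Q?) (λ x∈ → ∈-members Q? (P⊆Q _ (members-∈ P? x∈)))

    size-strict : (∀ x → P x → Q x) → ∀ {b} → Q b → ¬ P b → size P? < size Q?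
    size-strict P⊆Q qb ¬pb = length-⊂ (members-unique P?) (members-unique Q?)
                               (λ x∈ → ∈-members Q? (P⊆Q _ (members-∈ P? x∈)))
                               (∈-members Q? qb) (λ b∈ → ¬pb (members-∈ P? b∈))

    map-members-↭ : (f : A → A) → (∀ {a b} → f a ≡ f b → a ≡ b) → (∀ x → P x → Q (f x)) →
                    (∀ y → Q y → ∃ λ x → P x × f x ≡ y) → map f (members P?) ↭ members Q?
    map-members-↭ f f-inj P→Q Q→P = ↭-same-members (Uniqueₚ.map⁺ f-inj (members-unique P?)) (members-unique Q?)
      (λ y∈ → let (x , x∈ , y≡fx) = ∈-map⁻ f y∈ in
              subst (_∈ members Q?) (sym y≡fx) (∈-members Q? (P→Q x (members-∈ P? x∈))))
      (λ {y} y∈ → let (x , px , fx≡y) = Q→P y (members-∈ Q? y∈) in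
                  subst (_∈ map f (members P?)) fx≡y (∈-map⁺ f (∈-members P? px)))

    size-bij : (f : A → A) → (∀ {a b} → f a ≡ f b → a ≡ b) → (∀ x → P x → Q (f x)) →
               (∀ y → Q y → ∃ λ x → P x × f x ≡ y) → size P? ≡ size Q?
    size-bij f f-inj P→Q Q→P = ≡-trans (sym (length-map f (members P?))) (↭-length (map-members-↭ f f-inj P→Q Q→P))

  occurs-once : ∀ {a} (T : List A) → Unique T → a ∈ T → length (filter (a ≟_) T) ≡ 1
  occurs-once {a} (t ∷ T) (t∉T ∷ uT) a∈ with a ≟ t
  ... | yes refl = cong suc (cong length (filter-none (a ≟_) t∉T))
  ... | no a≢t with a∈
  ...   | here a≡t  = ⊥-elim (a≢t a≡t)
  ...   | there a∈T = occurs-once T uT a∈T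

  partition-by-image : (f : A → A) (T : List A) → Unique T → ∀ L → (∀ {x} → x ∈ L → f x ∈ T) →
                       length L ≡ sum (map (λ t → length (filter (λ x → f x ≟ t) L)) T)
  partition-by-image f T uT [] _ = sym (≡-trans (sum-const 0 T) (*-zeroʳ (length T)))
  partition-by-image f T uT (x ∷ L) f[x∷L]⊆T = begin
      suc (length L)
        ≡⟨ +-comm 1 (length L) ⟩
      length L + 1
        ≡⟨ cong₂ _+_ (partition-by-image f T uT L (λ y∈L → f[x∷L]⊆T (there y∈L)))
                     (sym (occurs-once T uT (f[x∷L]⊆T (here refl)))) ⟩
      sum (map (fibre L) T) + length (filter (f x ≟_) T)
        ≡⟨ cong (sum (map (fibre L) T) +_) (≡-trans (sym (*-identityʳ _)) (sym (sum-const 1 (filter (f x ≟_) T)))) ⟩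
      sum (map (fibre L) T) + sum (map (λ _ → 1) (filter (f x ≟_) T))
        ≡⟨ sum-split (f x ≟_) (fibre (x ∷ L)) (fibre L) (λ _ → 1) hit miss T ⟨
      sum (map (fibre (x ∷ L)) T) ∎
    where
    open ≡-Reasoning
    fibre : List A → A → ℕ
    fibre L t = length (filter (λ y → f y ≟ t) L)
    hit : ∀ t → f x ≡ t → fibre (x ∷ L) t ≡ fibre L t + 1
    hit t fx≡t = ≡-trans (cong length (filter-accept (λ y → f y ≟ t) fx≡t)) (+-comm 1 (fibre L t))
    miss : ∀ t → ¬ f x ≡ t → fibre (x ∷ L) t ≡ fibre L t
    miss t fx≢t = cong length (filter-reject (λ y → f y ≟ t) fx≢t)

  size-by-fibres : {P Q : Pred A 0ℓ} (P? : Decidable P) (Q? : Decidable Q) (f : A → A) →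
                   (∀ x → P x → Q (f x)) → ∀ c → (∀ t → Q t → size (λ x → P? x ×-dec (f x ≟ t)) ≡ c) →
                   size P? ≡ size Q? * c
  size-by-fibres P? Q? f P→Q c fibre-size = begin
      size P?
        ≡⟨ partition-by-image f (members Q?) (members-unique Q?) (members P?)
             (λ x∈ → ∈-members Q? (P→Q _ (members-∈ P? x∈))) ⟩
      sum (map (λ t → length (filter (λ x → f x ≟ t) (members P?))) (members Q?))
        ≡⟨ sum-cong _ (λ _ → c) (members Q?) (λ {t} t∈ → ≡-trans (cong length (filter-∩ P? (λ x → f x ≟ t) elements))
                                                                  (fibre-size t (members-∈ Q? t∈))) ⟩
      sum (map (λ _ → c) (members Q?))
        ≡⟨ sum-const c (members Q?) ⟩
      size Q? * c ∎
    where open ≡-Reasoning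

module FieldArithmetic (F : FiniteField) where

  open FiniteField F

  commutativeRing : CommutativeRing 0ℓ 0ℓ
  commutativeRing = record { isCommutativeRing = isCommutativeRing }

  module R = CommutativeRing commutativeRing
  open import Algebra.Properties.Ring R.ring public
    using (-1*x≈-x; -‿involutive; ⁻¹-anti-homo‿-; -‿+-comm; //-rightDividesˡ; +-cancelˡ; x∙y⁻¹≈ε⇒x≈y; x[y-z]≈xy-xz)
  open import Algebra.Solver.Ring.NaturalCoefficients.Default R.commutativeSemiring public
    using (solve; _:+_; _:*_; _:=_; con)
  import Algebra.Properties.CommutativeSemiring.Exp R.commutativeSemiring as Exp
  open ≡-Reasoning

  sub-swap : ∀ a b → b - a ≡ (- 1#) * (a - b)
  sub-swap a b = ≡-trans (sym (⁻¹-anti-homo‿- a b)) (sym (-1*x≈-x (a - b)))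

  translate-sub : ∀ v a b → (v + a) - (v + b) ≡ a - b
  translate-sub v a b = begin
    (v + a) + - (v + b)     ≡⟨ cong ((v + a) +_) (-‿+-comm v b) ⟨
    (v + a) + (- v + - b)   ≡⟨ solve 4 (λ v a v′ b′ → (v :+ a) :+ (v′ :+ b′) := (v :+ v′) :+ (a :+ b′)) refl v a (- v) (- b) ⟩
    (v - v) + (a - b)       ≡⟨ cong (_+ (a - b)) (R.-‿inverseʳ v) ⟩
    0# + (a - b)            ≡⟨ R.+-identityˡ (a - b) ⟩
    a - b ∎

  sub-translate : ∀ v s → v - (v + s) ≡ - s
  sub-translate v s = begin
    v + - (v + s)     ≡⟨ cong (v +_) (-‿+-comm v s) ⟨
    v + (- v + - s)   ≡⟨ R.+-assoc v (- v) (- s) ⟨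
    (v - v) + - s     ≡⟨ cong (_+ - s) (R.-‿inverseʳ v) ⟩
    0# + - s          ≡⟨ R.+-identityˡ (- s) ⟩
    - s ∎

  add-sub : ∀ v y → v + (y - v) ≡ y
  add-sub v y = ≡-trans (R.+-comm v (y - v)) (//-rightDividesˡ v y)

  Nonzero : Carrier → Set
  Nonzero x = ¬ x ≡ 0#

  nonzero? : ∀ x → Dec (Nonzero x)
  nonzero? x = ¬? (x ≟ 0#)

  1-nonzero : Nonzero 1#
  1-nonzero 1≡0 = 0≢1 (sym 1≡0)

  inv : ∀ x → Nonzero x → Carrier
  inv x x≢0 = proj₁ (inverse x x≢0)

  *-inverseʳ : ∀ x (x≢0 : Nonzero x) → x * inv x x≢0 ≡ 1#
  *-inverseʳ x x≢0 = proj₂ (inverse x x≢0)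

  *-inverseˡ : ∀ x (x≢0 : Nonzero x) → inv x x≢0 * x ≡ 1#
  *-inverseˡ x x≢0 = ≡-trans (R.*-comm _ x) (*-inverseʳ x x≢0)

  inv-cancel : ∀ x (x≢0 : Nonzero x) y → inv x x≢0 * (x * y) ≡ y
  inv-cancel x x≢0 y = begin
    inv x x≢0 * (x * y)   ≡⟨ R.*-assoc _ x y ⟨
    (inv x x≢0 * x) * y   ≡⟨ cong (_* y) (*-inverseˡ x x≢0) ⟩
    1# * y                ≡⟨ R.*-identityˡ y ⟩
    y ∎

  cancel-inv : ∀ x (x≢0 : Nonzero x) y → x * (inv x x≢0 * y) ≡ y
  cancel-inv x x≢0 y = begin
    x * (inv x x≢0 * y)   ≡⟨ R.*-assoc x _ y ⟨
    (x * inv x x≢0) * y   ≡⟨ cong (_* y) (*-inverseʳ x x≢0) ⟩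
    1# * y                ≡⟨ R.*-identityˡ y ⟩
    y ∎

  *-cancelˡ : ∀ x → Nonzero x → ∀ {a b} → x * a ≡ x * b → a ≡ b
  *-cancelˡ x x≢0 {a} {b} xa≡xb = begin
    a                     ≡⟨ inv-cancel x x≢0 a ⟨
    inv x x≢0 * (x * a)   ≡⟨ cong (inv x x≢0 *_) xa≡xb ⟩
    inv x x≢0 * (x * b)   ≡⟨ inv-cancel x x≢0 b ⟩
    b ∎

  *-nonzero : ∀ {x y} → Nonzero x → Nonzero y → Nonzero (x * y)
  *-nonzero {x} {y} x≢0 y≢0 xy≡0 = y≢0 (*-cancelˡ x x≢0 (≡-trans xy≡0 (sym (R.zeroʳ x))))

  inv-nonzero : ∀ x (x≢0 : Nonzero x) → Nonzero (inv x x≢0)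
  inv-nonzero x x≢0 inv≡0 = 1-nonzero (begin
    1#                ≡⟨ *-inverseʳ x x≢0 ⟨
    x * inv x x≢0     ≡⟨ cong (x *_) inv≡0 ⟩
    x * 0#            ≡⟨ R.zeroʳ x ⟩
    0# ∎)

  ^-≡ : ∀ x n → x ^ n ≡ x Exp.^ n
  ^-≡ x zero    = refl
  ^-≡ x (suc n) = cong (x *_) (^-≡ x n)

  ^-distrib-* : ∀ x y n → (x * y) ^ n ≡ x ^ n * y ^ n
  ^-distrib-* x y n = begin
    (x * y) ^ n             ≡⟨ ^-≡ (x * y) n ⟩
    (x * y) Exp.^ n         ≡⟨ Exp.^-distrib-* x y n ⟩
    x Exp.^ n * y Exp.^ n   ≡⟨ cong₂ _*_ (^-≡ x n) (^-≡ y n) ⟨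
    x ^ n * y ^ n ∎

  ^-assoc : ∀ x m n → (x ^ m) ^ n ≡ x ^ (m Nat.* n)
  ^-assoc x m n = begin
    (x ^ m) ^ n             ≡⟨ ^-≡ (x ^ m) n ⟩
    (x ^ m) Exp.^ n         ≡⟨ cong (Exp._^ n) (^-≡ x m) ⟩
    (x Exp.^ m) Exp.^ n     ≡⟨ Exp.^-assocʳ x m n ⟩
    x Exp.^ (m Nat.* n)     ≡⟨ ^-≡ x (m Nat.* n) ⟨
    x ^ (m Nat.* n) ∎

  1^n : ∀ n → 1# ^ n ≡ 1#
  1^n zero    = refl
  1^n (suc n) = ≡-trans (R.*-identityˡ _) (1^n n)

  ^-nonzero : ∀ {x} n → Nonzero x → Nonzero (x ^ n)
  ^-nonzero zero    x≢0 = 1-nonzero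
  ^-nonzero (suc n) x≢0 = *-nonzero x≢0 (^-nonzero n x≢0)

  ^-nonzero⁻ : ∀ {x} n → Nonzero (x ^ suc n) → Nonzero x
  ^-nonzero⁻ {x} n xⁿ≢0 x≡0 = xⁿ≢0 (≡-trans (cong (λ y → y * y ^ n) x≡0) (R.zeroˡ _))

module FieldCounting (F : FiniteField) where

  open FiniteField F
  open FieldArithmetic F
  open Enumerated _≟_ elements unique complete public
  open ≡-Reasoning

  #nonzero : ℕ
  #nonzero = size nonzero?

  order≡1+#nonzero : order ≡ suc #nonzero
  order≡1+#nonzero = ↭-length (↭-same-members unique
    (All.tabulate (λ x∈ 0≡x → members-∈ nonzero? x∈ (sym 0≡x)) ∷ members-unique nonzero?)
    (λ {x} _ → case x ≟ 0# of λ { (yes x≡0) → here x≡0 ; (no x≢0) → there (∈-members nonzero? x≢0) })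
    (λ {x} _ → complete x))

  #nonzero-positive : 1 ≤ #nonzero
  #nonzero-positive = filter-some nonzero? (Any.map (λ { refl → 1-nonzero }) (complete 1#))

  -- Fermat's little theorem: multiplication by x ≠ 0 permutes the nonzero
  -- elements, so comparing products gives x ^ (q - 1) = 1.

  product : List Carrier → Carrier
  product = foldr _*_ 1#

  product-↭ : ∀ {xs ys} → xs ↭ ys → product xs ≡ product ys
  product-↭ xs↭ys = foldr-commMonoid R.*-isCommutativeMonoid (↭⇒↭ₛ xs↭ys)
    where open import Data.List.Relation.Binary.Permutation.Setoid.Properties (≡.setoid Carrier) using (foldr-commMonoid)

  product-scale : ∀ x L → product (map (x *_) L) ≡ x ^ length L * product L
  product-scale x []      = sym (R.*-identityˡ 1#)
  product-scale x (y ∷ L) = begin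
    (x * y) * product (map (x *_) L)       ≡⟨ cong ((x * y) *_) (product-scale x L) ⟩
    (x * y) * (x ^ length L * product L)   ≡⟨ solve 4 (λ x y p P → (x :* y) :* (p :* P) := (x :* p) :* (y :* P)) refl x y _ _ ⟩
    (x * x ^ length L) * (y * product L) ∎

  product-nonzero : ∀ L → All Nonzero L → Nonzero (product L)
  product-nonzero []      []           = 1-nonzero
  product-nonzero (y ∷ L) (y≢0 ∷ L≢0) = *-nonzero y≢0 (product-nonzero L L≢0)

  fermat : ∀ {x} → Nonzero x → x ^ #nonzero ≡ 1#
  fermat {x} x≢0 = sym (*-cancelˡ P P≢0 (begin
      P * 1#                              ≡⟨ R.*-identityʳ P ⟩
      P                                   ≡⟨ product-↭ scaled↭ ⟨
      product (map (x *_) (members nonzero?)) ≡⟨ product-scale x (members nonzero?) ⟩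
      x ^ #nonzero * P                    ≡⟨ R.*-comm _ P ⟩
      P * x ^ #nonzero ∎))
    where
    P = product (members nonzero?)
    P≢0 : Nonzero P
    P≢0 = product-nonzero (members nonzero?) (All.tabulate (members-∈ nonzero?))
    scaled↭ : map (x *_) (members nonzero?) ↭ members nonzero?
    scaled↭ = map-members-↭ nonzero? nonzero? (x *_) (*-cancelˡ x x≢0) (λ y y≢0 → *-nonzero x≢0 y≢0)
                (λ y y≢0 → inv x x≢0 * y , *-nonzero (inv-nonzero x x≢0) y≢0 , cancel-inv x x≢0 y)

  -- The root bound.  A monic polynomial of degree n is represented by the
  -- list of its n lower coefficients: a ∷ p stands for a + X · p, and []
  -- for the constant 1.

  evalMonic : List Carrier → Carrier → Carrier
  evalMonic []      x = 1#
  evalMonic (a ∷ p) x = a + x * evalMonic p x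

  -- the quotient of the division by X - r (synthetic division)
  divideBy : Carrier → List Carrier → List Carrier
  divideBy r []          = []
  divideBy r (a ∷ [])    = []
  divideBy r (a ∷ b ∷ p) = evalMonic (b ∷ p) r ∷ divideBy r (b ∷ p)

  length-divideBy : ∀ r a p → length (divideBy r (a ∷ p)) ≡ length p
  length-divideBy r a []      = refl
  length-divideBy r a (b ∷ p) = cong suc (length-divideBy r b p)

  division : ∀ r t a p → evalMonic (a ∷ p) (r + t) ≡ t * evalMonic (divideBy r (a ∷ p)) (r + t) + evalMonic (a ∷ p) r
  division r t a [] = solve 3 (λ a r t → a :+ (r :+ t) :* con 1 := t :* con 1 :+ (a :+ r :* con 1)) refl a r t
  division r t a (b ∷ p) = begin
      a + (r + t) * evalMonic (b ∷ p) (r + t)     ≡⟨ cong (λ z → a + (r + t) * z) (division r t b p) ⟩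
      a + (r + t) * (t * D + M)                   ≡⟨ solve 5 (λ a r t D M → a :+ (r :+ t) :* (t :* D :+ M)
                                                                := t :* (M :+ (r :+ t) :* D) :+ (a :+ r :* M)) refl a r t D M ⟩
      t * (M + (r + t) * D) + (a + r * M) ∎
    where
    D = evalMonic (divideBy r (b ∷ p)) (r + t)
    M = evalMonic (b ∷ p) r

  root-bound : ∀ p (rs : List Carrier) → Unique rs → All (λ x → evalMonic p x ≡ 0#) rs → length rs ≤ length p
  root-bound p       []       _           _             = z≤n
  root-bound []      (r ∷ rs) _           (1≡0 ∷ _)     = ⊥-elim (1-nonzero 1≡0)
  root-bound (a ∷ p) (r ∷ rs) (r∉rs ∷ urs) (pr≡0 ∷ prs≡0) =
    s≤s (≤-trans (root-bound (divideBy r (a ∷ p)) rs urs (All.zipWith rootOfQuotient (r∉rs , prs≡0)))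
                 (≤-reflexive (length-divideBy r a p)))
    where
    rootOfQuotient : ∀ {x} → ¬ r ≡ x × evalMonic (a ∷ p) x ≡ 0# → evalMonic (divideBy r (a ∷ p)) x ≡ 0#
    rootOfQuotient {x} (r≢x , px≡0) = subst (λ y → evalMonic (divideBy r (a ∷ p)) y ≡ 0#) (add-sub r x)
      (*-cancelˡ (x - r) (λ d≡0 → r≢x (sym (x∙y⁻¹≈ε⇒x≈y x r d≡0))) (begin
        (x - r) * evalMonic (divideBy r (a ∷ p)) (r + (x - r))
          ≡⟨ R.+-identityʳ _ ⟨
        (x - r) * evalMonic (divideBy r (a ∷ p)) (r + (x - r)) + 0#
          ≡⟨ cong ((x - r) * evalMonic (divideBy r (a ∷ p)) (r + (x - r)) +_) pr≡0 ⟨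
        (x - r) * evalMonic (divideBy r (a ∷ p)) (r + (x - r)) + evalMonic (a ∷ p) r
          ≡⟨ division r (x - r) a p ⟨
        evalMonic (a ∷ p) (r + (x - r))
          ≡⟨ cong (evalMonic (a ∷ p)) (add-sub r x) ⟩
        evalMonic (a ∷ p) x
          ≡⟨ px≡0 ⟩
        0#
          ≡⟨ R.zeroʳ (x - r) ⟨
        (x - r) * 0# ∎))

  -- The k-th roots of unity: at most k of them, as roots of X^k - 1.

  μ : ℕ → Pred Carrier 0ℓ
  μ k x = x ^ k ≡ 1#

  μ? : ∀ k → Decidable (μ k)
  μ? k x = (x ^ k) ≟ 1#

  μ-bound : ∀ k → size (μ? (suc k)) ≤ suc k
  μ-bound k = ≤-trans
      (root-bound Xᵏ⁺¹-1 (members (μ? (suc k))) (members-unique (μ? (suc k)))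
                  (All.tabulate (λ x∈ → root (members-∈ (μ? (suc k)) x∈))))
      (≤-reflexive (cong suc (length-replicate k)))
    where
    Xᵏ⁺¹-1 : List Carrier
    Xᵏ⁺¹-1 = - 1# ∷ replicate k 0#
    evalMonic-Xᵏ : ∀ j x → evalMonic (replicate j 0#) x ≡ x ^ j
    evalMonic-Xᵏ zero    x = refl
    evalMonic-Xᵏ (suc j) x = ≡-trans (R.+-identityˡ _) (cong (x *_) (evalMonic-Xᵏ j x))
    root : ∀ {x} → x ^ suc k ≡ 1# → evalMonic Xᵏ⁺¹-1 x ≡ 0#
    root {x} xᵏ⁺¹≡1 = begin
      - 1# + x * evalMonic (replicate k 0#) x   ≡⟨ cong (λ z → - 1# + x * z) (evalMonic-Xᵏ k x) ⟩
      - 1# + x ^ suc k                          ≡⟨ cong (- 1# +_) xᵏ⁺¹≡1 ⟩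
      - 1# + 1#                                 ≡⟨ R.-‿inverseˡ 1# ⟩
      0# ∎

  -- The k-th power map sends the nonzero elements onto S_k, and its fibre
  -- over y₀ ^ k is the coset y₀ · μ_k; hence q - 1 = |S_k| · |μ_k|.
  nonzero-by-powers : ∀ k → #nonzero ≡ size (S? F (suc k)) Nat.* size (μ? (suc k))
  nonzero-by-powers k =
    size-by-fibres nonzero? (S? F (suc k)) (_^ suc k) (λ x x≢0 → ^-nonzero (suc k) x≢0 , x , refl) _ fibre
    where
    fibre : ∀ t → S F (suc k) t → size (λ x → nonzero? x ×-dec ((x ^ suc k) ≟ t)) ≡ size (μ? (suc k))
    fibre t (t≢0 , y₀ , y₀ᵏ≡t) = sym (size-bij (μ? (suc k)) _ (y₀ *_) (*-cancelˡ y₀ y₀≢0) toFibre fromFibre)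
      where
      y₀≢0 : Nonzero y₀
      y₀≢0 = ^-nonzero⁻ k (subst Nonzero (sym y₀ᵏ≡t) t≢0)
      toFibre : ∀ ζ → μ (suc k) ζ → Nonzero (y₀ * ζ) × (y₀ * ζ) ^ suc k ≡ t
      toFibre ζ ζᵏ≡1 = *-nonzero y₀≢0 (^-nonzero⁻ k (subst Nonzero (sym ζᵏ≡1) 1-nonzero)) , (begin
        (y₀ * ζ) ^ suc k          ≡⟨ ^-distrib-* y₀ ζ (suc k) ⟩
        y₀ ^ suc k * ζ ^ suc k    ≡⟨ cong₂ _*_ y₀ᵏ≡t ζᵏ≡1 ⟩
        t * 1#                    ≡⟨ R.*-identityʳ t ⟩
        t ∎)
      fromFibre : ∀ x → Nonzero x × x ^ suc k ≡ t → ∃ λ ζ → μ (suc k) ζ × y₀ * ζ ≡ x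
      fromFibre x (_ , xᵏ≡t) = inv y₀ y₀≢0 * x , (begin
        (inv y₀ y₀≢0 * x) ^ suc k          ≡⟨ ^-distrib-* _ x (suc k) ⟩
        inv y₀ y₀≢0 ^ suc k * x ^ suc k    ≡⟨ cong (inv y₀ y₀≢0 ^ suc k *_) (≡-trans xᵏ≡t (sym y₀ᵏ≡t)) ⟩
        inv y₀ y₀≢0 ^ suc k * y₀ ^ suc k   ≡⟨ ^-distrib-* _ y₀ (suc k) ⟨
        (inv y₀ y₀≢0 * y₀) ^ suc k         ≡⟨ cong (_^ suc k) (*-inverseˡ y₀ y₀≢0) ⟩
        1# ^ suc k                         ≡⟨ 1^n (suc k) ⟩
        1# ∎) , cancel-inv y₀ y₀≢0 x

  powers-are-roots : ∀ k j → suc k Nat.* j ≡ #nonzero → ∀ y → S F (suc k) y → μ j y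
  powers-are-roots k j kj≡q-1 y (y≢0 , x , xᵏ≡y) = begin
    y ^ j                    ≡⟨ cong (_^ j) xᵏ≡y ⟨
    (x ^ suc k) ^ j          ≡⟨ ^-assoc x (suc k) j ⟩
    x ^ (suc k Nat.* j)      ≡⟨ cong (x ^_) kj≡q-1 ⟩
    x ^ #nonzero             ≡⟨ fermat (^-nonzero⁻ k (subst Nonzero (sym xᵏ≡y) y≢0)) ⟩
    1# ∎

  -- If k · m = q - 1, there are exactly k k-th roots of unity: at most k by
  -- the root bound, and at least k since, counting m-th powers by fibres,
  -- k · m = |S_m| · |μ_m| ≤ |μ_k| · m.
  μ-exact : ∀ k m → suc k Nat.* suc m ≡ #nonzero → size (μ? (suc k)) ≡ suc k
  μ-exact k m km≡q-1 = ≤-antisym (μ-bound k) (*-cancelʳ-≤ (suc k) (size (μ? (suc k))) (suc m)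
      (≤-trans (≤-reflexive (≡-trans km≡q-1 (nonzero-by-powers m)))
               (*-mono-≤ mPowers⊆μₖ (μ-bound m))))
    where
    mPowers⊆μₖ : size (S? F (suc m)) ≤ size (μ? (suc k))
    mPowers⊆μₖ = size-mono (S? F (suc m)) (μ? (suc k)) (powers-are-roots m (suc k) (≡-trans (*-comm (suc m) (suc k)) km≡q-1))

  S-size : ∀ k → suc k ∣ #nonzero → size (S? F (suc k)) Nat.* suc k ≡ #nonzero
  S-size k (divides zero q-1≡0)      = ⊥-elim (<-irrefl (sym q-1≡0) #nonzero-positive)
  S-size k (divides (suc m) q-1≡mk) = begin
    size (S? F (suc k)) Nat.* suc k                 ≡⟨ cong (size (S? F (suc k)) Nat.*_) (μ-exact k m km≡q-1) ⟨
    size (S? F (suc k)) Nat.* size (μ? (suc k))     ≡⟨ nonzero-by-powers k ⟨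
    #nonzero ∎
    where
    km≡q-1 : suc k Nat.* suc m ≡ #nonzero
    km≡q-1 = ≡-trans (*-comm (suc k) (suc m)) (sym q-1≡mk)

  -1²≡1 : (- 1#) ^ 2 ≡ 1#
  -1²≡1 = begin
    - 1# * (- 1# * 1#)   ≡⟨ cong (- 1# *_) (R.*-identityʳ (- 1#)) ⟩
    - 1# * - 1#          ≡⟨ -1*x≈-x (- 1#) ⟩
    - (- 1#)             ≡⟨ -‿involutive 1# ⟩
    1# ∎

  -- If q is even then -1 = 1: otherwise 1 and -1 would be two square roots
  -- of unity, and q - 1 = |S_2| · |μ_2| would be even as well.
  -1∈S-even : ∀ k → 2 ∣ order → S F k (- 1#)
  -1∈S-even k 2∣q with (- 1#) ≟ 1#
  ... | yes -1≡1 = (λ -1≡0 → 1-nonzero (≡-trans (sym -1≡1) -1≡0)) , 1# , ≡-trans (1^n k) (sym -1≡1)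
  ... | no -1≢1 = ⊥-elim (2≢1 (∣1⇒≡1 (∣m+n∣m⇒∣n 2∣q-1+1 2∣q-1)))
    where
    ±1 : List Carrier
    ±1 = 1# ∷ - 1# ∷ []
    ±1-unique : Unique ±1
    ±1-unique = ((λ 1≡-1 → -1≢1 (sym 1≡-1)) ∷ []) ∷ [] ∷ []
    ±1⊆μ₂ : ∀ {x} → x ∈ ±1 → x ∈ members (μ? 2)
    ±1⊆μ₂ (here refl)         = ∈-members (μ? 2) (1^n 2)
    ±1⊆μ₂ (there (here refl)) = ∈-members (μ? 2) -1²≡1
    μ₂≡2 : size (μ? 2) ≡ 2
    μ₂≡2 = ≤-antisym (μ-bound 1) (length-⊆ ±1-unique (members-unique (μ? 2)) ±1⊆μ₂)
    2∣q-1 : 2 ∣ #nonzero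
    2∣q-1 = divides (size (S? F 2)) (≡-trans (nonzero-by-powers 1) (cong (size (S? F 2) Nat.*_) μ₂≡2))
    2∣q-1+1 : 2 ∣ #nonzero Nat.+ 1
    2∣q-1+1 = subst (2 ∣_) (≡-trans order≡1+#nonzero (+-comm 1 #nonzero)) 2∣q
    2≢1 : ¬ 2 ≡ 1
    2≢1 ()

  -- If 2k divides q - 1 then -1 is a k-th power: writing q - 1 = k · m, the
  -- m elements of S_k are m-th roots of unity, and so is -1 since m is
  -- even; there being at most m of those, -1 must lie in S_k.
  -1∈S-odd : ∀ k → 2 Nat.* suc k ∣ #nonzero → S F (suc k) (- 1#)
  -1∈S-odd k (divides zero q-1≡0) = ⊥-elim (<-irrefl (sym q-1≡0) #nonzero-positive)
  -1∈S-odd k (divides (suc j) q-1≡j2k) with S? F (suc k) (- 1#)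
  ... | yes -1∈S = -1∈S
  ... | no -1∉S  = ⊥-elim (<-irrefl S≡m (<-≤-trans S<μₘ (μ-bound (Nat.pred m))))
    where
    m = 2 Nat.* suc j
    km≡q-1 : suc k Nat.* m ≡ #nonzero
    km≡q-1 = ≡-trans (rearrange j k) (sym q-1≡j2k)
      where
      rearrange : ∀ j k → suc k Nat.* (2 Nat.* suc j) ≡ suc j Nat.* (2 Nat.* suc k)
      rearrange = solve-∀
    S<μₘ : size (S? F (suc k)) < size (μ? m)
    S<μₘ = size-strict (S? F (suc k)) (μ? m) (powers-are-roots k m km≡q-1) -1∈μₘ -1∉S
      where
      -1∈μₘ : μ m (- 1#)
      -1∈μₘ = ≡-trans (sym (^-assoc (- 1#) 2 (suc j))) (≡-trans (cong (_^ suc j) -1²≡1) (1^n (suc j)))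
    S≡m : size (S? F (suc k)) ≡ m
    S≡m = *-cancelʳ-≡ _ m (suc k) (≡-trans (S-size k (divides m q-1≡mk)) q-1≡mk)
      where
      q-1≡mk : #nonzero ≡ m Nat.* suc k
      q-1≡mk = ≡-trans (sym km≡q-1) (*-comm (suc k) m)

  admissible-order : ∀ d → (2 ∣ order → suc d ∣ order Nat.∸ 1) → (¬ 2 ∣ order → 2 Nat.* suc d ∣ order Nat.∸ 1) →
                     S F (suc d) (- 1#) × size (S? F (suc d)) Nat.* suc d ≡ order Nat.∸ 1
  admissible-order d k∣q-1-if-even 2k∣q-1-if-odd =
    -1∈S , ≡-trans (S-size d (subst (suc d ∣_) q-1≡#nonzero k∣q-1)) (sym q-1≡#nonzero)
    where
    q-1≡#nonzero : order Nat.∸ 1 ≡ #nonzero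
    q-1≡#nonzero = cong (Nat._∸ 1) order≡1+#nonzero
    -1∈S : S F (suc d) (- 1#)
    -1∈S with 2 ∣? order
    ... | yes 2∣q = -1∈S-even (suc d) 2∣q
    ... | no 2∤q  = -1∈S-odd d (subst (2 Nat.* suc d ∣_) q-1≡#nonzero (2k∣q-1-if-odd 2∤q))
    k∣q-1 : suc d ∣ order Nat.∸ 1
    k∣q-1 with 2 ∣? order
    ... | yes 2∣q = k∣q-1-if-even 2∣q
    ... | no 2∤q  = ∣-trans (divides 2 refl) (2k∣q-1-if-odd 2∤q)

-- The generalized Paley graph G_k(q), k ≥ 1, when -1 is a k-th power, so
-- that adjacency is symmetric.
module PaleyGraph (F : FiniteField) (d : ℕ) where

  open FiniteField F
  open FieldArithmetic F
  open Enumerated _≟_ elements unique complete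
  open Sums
  open ≡-Reasoning

  k : ℕ
  k = suc d

  S-* : ∀ {x y} → S F k x → S F k y → S F k (x * y)
  S-* {x} {y} (x≢0 , u , uᵏ≡x) (y≢0 , v , vᵏ≡y) =
    *-nonzero x≢0 y≢0 , u * v , ≡-trans (^-distrib-* u v k) (cong₂ _*_ uᵏ≡x vᵏ≡y)

  S-inv : ∀ {s} (s∈S : S F k s) → S F k (inv s (proj₁ s∈S))
  S-inv {s} (s≢0 , z , zᵏ≡s) = inv-nonzero s s≢0 , inv z z≢0 , *-cancelˡ s s≢0 (begin
      s * inv z z≢0 ^ k            ≡⟨ cong (_* inv z z≢0 ^ k) zᵏ≡s ⟨
      z ^ k * inv z z≢0 ^ k        ≡⟨ ^-distrib-* z (inv z z≢0) k ⟨
      (z * inv z z≢0) ^ k          ≡⟨ cong (_^ k) (*-inverseʳ z z≢0) ⟩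
      1# ^ k                       ≡⟨ 1^n k ⟩
      1#                           ≡⟨ *-inverseʳ s s≢0 ⟨
      s * inv s s≢0 ∎)
    where
    z≢0 : Nonzero z
    z≢0 = ^-nonzero⁻ d (subst Nonzero (sym zᵏ≡s) s≢0)

  module _ (-1∈S : S F k (- 1#)) where

    Adj-sym : ∀ {a b} → Adj F k a b → Adj F k b a
    Adj-sym {a} {b} a~b = subst (S F k) (sym (sub-swap a b)) (S-* -1∈S a~b)

    Adj-irrefl : ∀ a → ¬ Adj F k a a
    Adj-irrefl a (a-a≢0 , _) = a-a≢0 (R.-‿inverseʳ a)

    open Cliques (Adj F k) (Adj? F k)
    open Undirected Adj-sym Adj-irrefl

    Sₖ H¹ : List Carrier
    Sₖ = members (S? F k)
    H¹ = members (H1? F k)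

    -- The neighbourhood of any vertex v is v + S_k, and translation by v
    -- is a graph isomorphism: G_k(q) is vertex-transitive.
    nbrs-translate : ∀ v m → cliques (nbrs v elements) m ≡ cliques Sₖ m
    nbrs-translate v m = ≡-trans (cliques-↭ m (↭-sym translate↭)) (cliques-map (v +_) preserves reflects Sₖ m)
      where
      translate↭ : map (v +_) Sₖ ↭ nbrs v elements
      translate↭ = map-members-↭ (S? F k) (Adj? F k v) (v +_) (+-cancelˡ v _ _)
        (λ s s∈S → subst (S F k) (sym (sub-translate v s)) (subst (S F k) (-1*x≈-x s) (S-* -1∈S s∈S)))
        (λ y v~y → y - v , Adj-sym v~y , add-sub v y)
      preserves : ∀ {a b} → Adj F k a b → Adj F k (v + a) (v + b)
      preserves {a} {b} = subst (S F k) (sym (translate-sub v a b))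
      reflects : ∀ {a b} → Adj F k (v + a) (v + b) → Adj F k a b
      reflects {a} {b} = subst (S F k) (translate-sub v a b)

    -- The neighbourhood of s ∈ S_k inside H_k(q) is s · H¹_k(q), and
    -- multiplication by s is a graph isomorphism.
    nbrs-scale : ∀ s → S F k s → ∀ m → cliques (nbrs s Sₖ) m ≡ cliques H¹ m
    nbrs-scale s s∈S@(s≢0 , _) m = begin
        cliques (nbrs s Sₖ) m                                        ≡⟨ cong (λ L → cliques L m) (filter-∩ (S? F k) (Adj? F k s) elements) ⟩
        cliques (members (λ x → S? F k x ×-dec Adj? F k s x)) m    ≡⟨ cliques-↭ m scale↭ ⟨
        cliques (map (s *_) H¹) m                                    ≡⟨ cliques-map (s *_) preserves reflects H¹ m ⟩
        cliques H¹ m ∎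
      where
      s⁻¹ : Carrier
      s⁻¹ = inv s s≢0
      scale-sub : ∀ a b → (s * a) - (s * b) ≡ s * (a - b)
      scale-sub a b = sym (x[y-z]≈xy-xz s a b)
      scale↭ : map (s *_) H¹ ↭ members (λ x → S? F k x ×-dec Adj? F k s x)
      scale↭ = map-members-↭ (H1? F k) (λ x → S? F k x ×-dec Adj? F k s x) (s *_) (*-cancelˡ s s≢0)
        (λ y (y∈S , 1~y) → S-* s∈S y∈S ,
                           subst (S F k) (≡-trans (x[y-z]≈xy-xz s 1# y) (cong (_- (s * y)) (R.*-identityʳ s))) (S-* s∈S 1~y))
        (λ x (x∈S , s~x) → s⁻¹ * x ,
           (S-* (S-inv s∈S) x∈S ,
            subst (S F k) (≡-trans (x[y-z]≈xy-xz s⁻¹ s x) (cong (_- (s⁻¹ * x)) (*-inverseˡ s s≢0))) (S-* (S-inv s∈S) s~x)) ,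
           cancel-inv s s≢0 x)
      preserves : ∀ {a b} → Adj F k a b → Adj F k (s * a) (s * b)
      preserves {a} {b} a~b = subst (S F k) (sym (scale-sub a b)) (S-* s∈S a~b)
      reflects : ∀ {a b} → Adj F k (s * a) (s * b) → Adj F k a b
      reflects {a} {b} sa~sb = subst (S F k) (inv-cancel s s≢0 (a - b))
                                 (S-* (S-inv s∈S) (subst (S F k) (scale-sub a b) sa~sb))

    part-a : ∀ n → suc n Nat.* K-G F k (suc n) ≡ order Nat.* K-H F k n
    part-a n = begin
        suc n Nat.* cliques (filter (λ _ → yes tt) elements) (suc n)
          ≡⟨ cong (λ L → suc n Nat.* cliques L (suc n)) (filter-all (λ _ → yes tt) {xs = elements} (All.tabulate (λ _ → tt))) ⟩
        suc n Nat.* cliques elements (suc n)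
          ≡⟨ handshake n elements ⟩
        sum (map (λ v → cliques (nbrs v elements) n) elements)
          ≡⟨ sum-cong _ _ elements (λ {v} _ → nbrs-translate v n) ⟩
        sum (map (λ _ → cliques Sₖ n) elements)
          ≡⟨ sum-const (cliques Sₖ n) elements ⟩
        order Nat.* cliques Sₖ n ∎

    part-b : ∀ n → suc n Nat.* K-H F k (suc n) ≡ size (S? F k) Nat.* K-H1 F k n
    part-b n = begin
        suc n Nat.* cliques Sₖ (suc n)                  ≡⟨ handshake n Sₖ ⟩
        sum (map (λ s → cliques (nbrs s Sₖ) n) Sₖ)      ≡⟨ sum-cong _ _ Sₖ (λ s∈ → nbrs-scale _ (members-∈ (S? F k) s∈) n) ⟩
        sum (map (λ _ → cliques H¹ n) Sₖ)               ≡⟨ sum-const (cliques H¹ n) Sₖ ⟩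
        size (S? F k) Nat.* cliques H¹ n ∎

open Nat using (_+_; _*_; _∸_)

combine-parts : (G H H¹ : ℕ → ℕ) (k q r : ℕ) →
  (∀ n → 1 ≤ n → (n + 1) * G (n + 1) ≡ q * H n) →
  (∀ n → 1 ≤ n → k * (n + 1) * H (n + 1) ≡ r * H¹ n) →
  ∀ n → 2 ≤ n → k * n * (n + 1) * G (n + 1) ≡ q * r * H¹ (n ∸ 1)
combine-parts G H H¹ k q r part-a part-b (suc n) (s≤s 1≤n) = begin
    k * suc n * (suc n + 1) * G (suc n + 1)     ≡⟨ regroup k (suc n) (suc n + 1) (G (suc n + 1)) ⟩
    k * suc n * ((suc n + 1) * G (suc n + 1))   ≡⟨ cong (k * suc n *_) (part-a (suc n) (s≤s z≤n)) ⟩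
    k * suc n * (q * H (suc n))                 ≡⟨ pull-q k (suc n) q (H (suc n)) ⟩
    q * (k * suc n * H (suc n))                 ≡⟨ cong (λ m → q * (k * m * H m)) (+-comm 1 n) ⟩
    q * (k * (n + 1) * H (n + 1))               ≡⟨ cong (q *_) (part-b n 1≤n) ⟩
    q * (r * H¹ n)                              ≡⟨ *-assoc q r (H¹ n) ⟨
    q * r * H¹ n ∎
  where
  open ≡-Reasoning
  regroup : ∀ a b c g → a * b * c * g ≡ a * b * (c * g)
  regroup = solve-∀
  pull-q : ∀ a b q h → a * b * (q * h) ≡ q * (a * b * h)
  pull-q = solve-∀

-- Lemma 4.2.
lemma4p2 : (k : ℕ) → 2 ≤ k → (F : FiniteField) →
    IsPrimePower (FiniteField.order F) →
    (2 ∣ FiniteField.order F → k ∣ FiniteField.order F ∸ 1) →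
    (¬ (2 ∣ FiniteField.order F) → (2 * k) ∣ FiniteField.order F ∸ 1) →
    (∀ n → 1 ≤ n →
      (n + 1) * K-G F k (n + 1) ≡ FiniteField.order F * K-H F k n)
    × (∀ n → 1 ≤ n →
      k * (n + 1) * K-H F k (n + 1) ≡ (FiniteField.order F ∸ 1) * K-H1 F k n)
    × (∀ n → 2 ≤ n →
      k * n * (n + 1) * K-G F k (n + 1)
        ≡ FiniteField.order F * (FiniteField.order F ∸ 1) * K-H1 F k (n ∸ 1))
lemma4p2 k@(suc d@(suc _)) (s≤s (s≤s z≤n)) F _ k∣q-1-if-even 2k∣q-1-if-odd =
  part-a′ , part-b′ , combine-parts (K-G F k) (K-H F k) (K-H1 F k) k q (q ∸ 1) part-a′ part-b′
  where
  open FiniteField F using (order)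
  open FieldCounting F using (admissible-order; size)
  open PaleyGraph F d using (part-a; part-b)
  q = order
  -1∈S = proj₁ (admissible-order d k∣q-1-if-even 2k∣q-1-if-odd)
  |S|k≡q-1 = proj₂ (admissible-order d k∣q-1-if-even 2k∣q-1-if-odd)
  part-a′ : ∀ n → 1 ≤ n → (n + 1) * K-G F k (n + 1) ≡ q * K-H F k n
  part-a′ n _ = subst (λ m → m * K-G F k m ≡ q * K-H F k n) (+-comm 1 n) (part-a -1∈S n)
  part-b′ : ∀ n → 1 ≤ n → k * (n + 1) * K-H F k (n + 1) ≡ (q ∸ 1) * K-H1 F k n
  part-b′ n _ = begin
    k * (n + 1) * K-H F k (n + 1)        ≡⟨ cong (λ m → k * m * K-H F k m) (+-comm n 1) ⟩
    k * suc n * K-H F k (suc n)          ≡⟨ *-assoc k (suc n) _ ⟩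
    k * (suc n * K-H F k (suc n))        ≡⟨ cong (k *_) (part-b -1∈S n) ⟩
    k * (size (S? F k) * K-H1 F k n)     ≡⟨ regroup k (size (S? F k)) (K-H1 F k n) ⟩
    (size (S? F k) * k) * K-H1 F k n     ≡⟨ cong (_* K-H1 F k n) |S|k≡q-1 ⟩
    (q ∸ 1) * K-H1 F k n ∎
    where
    open ≡-Reasoning
    regroup : ∀ a b c → a * (b * c) ≡ (b * a) * c
    regroup = solve-∀
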